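{- Let $\mathcal C,\mathcal D$ be graph classes. If $\mathcal C$ and $\mathcal D$ are incomparable in $\sqsubseteq_{\mathrm{FO}}$, then $\mathcal C\cap\mathcal D\sqsubset_{\mathrm{FO}}\mathcal C\sqsubset_{\mathrm{FO}}\mathcal C\cup\mathcal D$. If $\mathcal C$ and $\mathcal D$ are incomparable in $\sqsubseteq^\circ_{\mathrm{FO}}$, then $\mathcal C\cap\mathcal D\sqsubset^\circ_{\mathrm{FO}}\mathcal C\sqsubset^\circ_{\mathrm{FO}}\mathcal C\cup\mathcal D$.
   Context: All graphs are finite, simple, undirected. A $\Sigma$-expansion of $G$ ($\Sigma$ a finite set of unary symbols) is $G$ with a subset of $V(G)$ for each symbol. A simple interpretation $(\nu(x),\eta(x,y))$ of first-order formulas over $\{E\}\cup\Sigma$ ($\eta$ symmetric, antireflexive) produces from $G^+$ the graph on $\nu(G^+)$ with edges $uv$ where $G^+\models\eta(u,v)$. A non-copying transduction is a pair $(\Sigma,\mathsf I)$, producing from $G$ all $\mathsf I(G^+)$. The $k$-copy operation maps $G$ to $k$ disjoint copies of $G$ with copies of each vertex made pairwise adjacent. A transduction is a finite composition of copy operations and non-copying transductions. $\mathcal C\sqsubseteq_{\mathrm{FO}}\mathcal D$ (resp. $\mathcal C\sqsubseteq^\circ_{\mathrm{FO}}\mathcal D$) means there is a transduction (resp. non-copying transduction) $\mathsf T$ such that every graph of $\mathcal C$ is produced by $\mathsf T$ from some graph of $\mathcal D$. $\mathcal C\sqsubset\mathcal D$ means $\mathcal C\sqsubseteq\mathcal D$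 and $\mathcal D\not\sqsubseteq\mathcal C$; incomparable means neither $\mathcal C\sqsubseteq\mathcal D$ nor $\mathcal D\sqsubseteq\mathcal C$. -}

module Defs where

open import Data.Nat using (ℕ; zero; suc)
open import Data.Fin using (Fin; zero; suc)
open import Data.Bool using (Bool; true; false; not; _∧_; _∨_)
open import Data.Product using (Σ; _×_; _,_; proj₁; proj₂)
open import Data.Sum using (_⊎_)
open import Data.List using (List; []; _∷_)
open import Relation.Nullary using (¬_)
open import Relation.Binary.PropositionalEquality using (_≡_; _≢_)
open import Function.Bundles using (_⤖_; Bijection)

record Graph : Set where
  field
    n   : ℕ
    E   : Fin n → Fin n → Bool
    sym : ∀ u v → E u v ≡ E v u
    irr : ∀ u → E u u ≡ false
open Graph public

GraphClass : Set₁
GraphClass = Graph → Set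

_∪ᶜ_ : GraphClass → GraphClass → GraphClass
(C ∪ᶜ D) G = C G ⊎ D G

_∩ᶜ_ : GraphClass → GraphClass → GraphClass
(C ∩ᶜ D) G = C G × D G

-- First-order formulas over {E} ∪ Σ, Σ = Fin s unary symbols,
-- with free variables among Fin k (de Bruijn style: ∃ binds variable 0).

data Formula (s : ℕ) : ℕ → Set where
  edge  : ∀ {k} → Fin k → Fin k → Formula s k
  equal : ∀ {k} → Fin k → Fin k → Formula s k
  color : ∀ {k} → Fin s → Fin k → Formula s k
  ¬'_   : ∀ {k} → Formula s k → Formula s k
  _∧'_  : ∀ {k} → Formula s k → Formula s k → Formula s k
  ∃'_   : ∀ {k} → Formula s (suc k) → Formula s k

-- A Σ-expansion of G: a subset of V(G) for each of the s symbols.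
Expansion : ℕ → Graph → Set
Expansion s G = Fin s → Fin (n G) → Bool

anyFin : ∀ {m} → (Fin m → Bool) → Bool
anyFin {zero}  f = false
anyFin {suc m} f = f zero ∨ anyFin (λ i → f (suc i))

eqFin : ∀ {m} → Fin m → Fin m → Bool
eqFin zero    zero    = true
eqFin zero    (suc _) = false
eqFin (suc _) zero    = false
eqFin (suc i) (suc j) = eqFin i j

extend : ∀ {A : Set} {k} → A → (Fin k → A) → Fin (suc k) → A
extend a ρ zero    = a
extend a ρ (suc i) = ρ i

eval : ∀ {s k} → Formula s k → (G : Graph) → Expansion s G → (Fin k → Fin (n G)) → Bool
eval (edge i j)  G c ρ = E G (ρ i) (ρ j)
eval (equal i j) G c ρ = eqFin (ρ i) (ρ j)
eval (color a i) G c ρ = c a (ρ i)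
eval (¬' φ)      G c ρ = not (eval φ G c ρ)
eval (φ ∧' ψ)    G c ρ = eval φ G c ρ ∧ eval ψ G c ρ
eval (∃' φ)      G c ρ = anyFin (λ v → eval φ G c (extend v ρ))

env1 : ∀ {A : Set} → A → Fin 1 → A
env1 a _ = a

env2 : ∀ {A : Set} → A → A → Fin 2 → A
env2 a b zero    = a
env2 a b (suc _) = b

record Interp (s : ℕ) : Set where
  field
    ν    : Formula s 1
    η    : Formula s 2
    ηsym : ∀ G (c : Expansion s G) u v →
           eval η G c (env2 u v) ≡ eval η G c (env2 v u)
    ηirr : ∀ G (c : Expansion s G) u → eval η G c (env2 u u) ≡ false
open Interp public

νSet : ∀ {s} → Interp s → (G : Graph) → Expansion s G → Set
νSet I G c = Σ (Fin (n G)) λ v → eval (ν I) G c (env1 v) ≡ true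

IsInterpOf : ∀ {s} → Interp s → (G : Graph) → Expansion s G → Graph → Set
IsInterpOf I G c H =
  Σ (Fin (n H) ⤖ νSet I G c) λ f →
    ∀ a b → E H a b ≡ eval (η I) G c
                        (env2 (proj₁ (Bijection.to f a)) (proj₁ (Bijection.to f b)))

ProducesNC : ∀ {s} → Interp s → Graph → Graph → Set
ProducesNC {s} I G H = Σ (Expansion s G) λ c → IsInterpOf I G c H

IsCopyOf : ℕ → Graph → Graph → Set
IsCopyOf k G H =
  Σ (Fin (n H) ⤖ (Fin k × Fin (n G))) λ f →
    ∀ a b → E H a b ≡
      (let (i , u) = Bijection.to f a ; (j , v) = Bijection.to f b in
        (eqFin i j ∧ E G u v) ∨ (not (eqFin i j) ∧ eqFin u v))

Iso : Graph → Graph → Set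
Iso G H = Σ (Fin (n H) ⤖ Fin (n G)) λ f →
  ∀ a b → E H a b ≡ E G (Bijection.to f a) (Bijection.to f b)

-- Transductions: finite compositions of copy operations and
-- non-copying transductions (applied left to right).

data Step : Set where
  copyStep   : ℕ → Step
  interpStep : (s : ℕ) → Interp s → Step

Transduction : Set
Transduction = List Step

Produces : Transduction → Graph → Graph → Set
Produces []                      G H = Iso G H
Produces (copyStep k ∷ T)        G H = Σ Graph λ G' → IsCopyOf k G G' × Produces T G' H
Produces (interpStep s I ∷ T)    G H = Σ Graph λ G' → ProducesNC I G G' × Produces T G' H

_⊑FO_ : GraphClass → GraphClass → Set
C ⊑FO D = Σ Transduction λ T → ∀ H → C H → Σ Graph λ G → D G × Produces T G H

_⊑°FO_ : GraphClass → GraphClass → Set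
C ⊑°FO D = Σ ℕ λ s → Σ (Interp s) λ I →
             ∀ H → C H → Σ Graph λ G → D G × ProducesNC I G H

_⊏FO_ : GraphClass → GraphClass → Set
C ⊏FO D = (C ⊑FO D) × ¬ (D ⊑FO C)

_⊏°FO_ : GraphClass → GraphClass → Set
C ⊏°FO D = (C ⊑°FO D) × ¬ (D ⊑°FO C)

IncomparableFO : GraphClass → GraphClass → Set
IncomparableFO C D = ¬ (C ⊑FO D) × ¬ (D ⊑FO C)

Incomparable°FO : GraphClass → GraphClass → Set
Incomparable°FO C D = ¬ (C ⊑°FO D) × ¬ (D ⊑°FO C)

-- Both quasi-orders contain inclusion of classes and are compatible with it on
-- either side. Hence C ∩ D ⊑ C ⊑ C ∪ D, while C ⊑ C ∩ D would give C ⊑ D and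
-- C ∪ D ⊑ C would give D ⊑ C, both excluded by incomparability.
{-# OPTIONS --safe #-}
module Submission where

open import Defs
open import Data.Product using (_×_; _,_; proj₁; proj₂)
open import Data.Sum using (inj₁; inj₂)
open import Data.Fin using (Fin; zero; suc)
open import Data.Bool using (true; not)
open import Data.Bool.Properties using (_≟_)
open import Data.List using ([])
open import Relation.Nullary using (¬_)
open import Relation.Binary.PropositionalEquality using (_≡_; refl; cong)
open import Function.Bundles using (mk⤖)
open import Function.Construct.Identity using (⤖-id)
open import Axiom.UniquenessOfIdentityProofs using (module Decidable⇒UIP)

_⊆ᶜ_ : GraphClass → GraphClass → Set
C ⊆ᶜ D = ∀ G → C G → D G

∩ᶜ-⊆ˡ : (C D : GraphClass) → (C ∩ᶜ D) ⊆ᶜ C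
∩ᶜ-⊆ˡ C D G = proj₁

∩ᶜ-⊆ʳ : (C D : GraphClass) → (C ∩ᶜ D) ⊆ᶜ D
∩ᶜ-⊆ʳ C D G = proj₂

∪ᶜ-⊆ˡ : (C D : GraphClass) → C ⊆ᶜ (C ∪ᶜ D)
∪ᶜ-⊆ˡ C D G = inj₁

∪ᶜ-⊆ʳ : (C D : GraphClass) → D ⊆ᶜ (C ∪ᶜ D)
∪ᶜ-⊆ʳ C D G = inj₂

module InclusionCompatible
  (_⊑_ : GraphClass → GraphClass → Set)
  (⊆⇒⊑ : ∀ {C D} → C ⊆ᶜ D → C ⊑ D)
  (⊑-respˡ-⊆ : ∀ {C C′ D} → C′ ⊆ᶜ C → C ⊑ D → C′ ⊑ D)
  (⊑-respʳ-⊆ : ∀ {C D D′} → D ⊆ᶜ D′ → C ⊑ D → C ⊑ D′)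
  where

  ∩-⊏ : ∀ C D → ¬ (C ⊑ D) → (C ∩ᶜ D) ⊑ C × ¬ (C ⊑ (C ∩ᶜ D))
  ∩-⊏ C D C⋢D = ⊆⇒⊑ (∩ᶜ-⊆ˡ C D) , λ C⊑C∩D → C⋢D (⊑-respʳ-⊆ (∩ᶜ-⊆ʳ C D) C⊑C∩D)

  ⊏-∪ : ∀ C D → ¬ (D ⊑ C) → C ⊑ (C ∪ᶜ D) × ¬ ((C ∪ᶜ D) ⊑ C)
  ⊏-∪ C D D⋢C = ⊆⇒⊑ (∪ᶜ-⊆ˡ C D) , λ C∪D⊑C → D⋢C (⊑-respˡ-⊆ (∪ᶜ-⊆ʳ C D) C∪D⊑C)

Iso-refl : (G : Graph) → Iso G G
Iso-refl G = ⤖-id _ , λ a b → refl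

⊆⇒⊑FO : ∀ {C D} → C ⊆ᶜ D → C ⊑FO D
⊆⇒⊑FO C⊆D = [] , λ H h → H , C⊆D H h , Iso-refl H

⊑FO-respˡ-⊆ : ∀ {C C′ D} → C′ ⊆ᶜ C → C ⊑FO D → C′ ⊑FO D
⊑FO-respˡ-⊆ C′⊆C (T , produce) = T , λ H h → produce H (C′⊆C H h)

⊑FO-respʳ-⊆ : ∀ {C D D′} → D ⊆ᶜ D′ → C ⊑FO D → C ⊑FO D′
⊑FO-respʳ-⊆ D⊆D′ (T , produce) = T , λ H h →
  let (G , g , p) = produce H h in G , D⊆D′ G g , p

-- ν(x) := ¬ E(x,x) holds everywhere by irreflexivity; a formula that is true by
-- mere evaluation is not available, since eqFin x x does not reduce for variable x.
identityInterp : Interp 0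
identityInterp = record
  { ν    = ¬' edge zero zero
  ; η    = edge zero (suc zero)
  ; ηsym = λ G c → sym G
  ; ηirr = λ G c → irr G
  }

identityInterp-ν : (G : Graph) (v : Fin (n G)) → not (E G v v) ≡ true
identityInterp-ν G v rewrite irr G v = refl

identityInterp-produces : (G : Graph) → ProducesNC identityInterp G G
identityInterp-produces G =
  (λ ()) ,
  mk⤖ {to = λ v → v , identityInterp-ν G v}
    ((λ eq → cong proj₁ eq) ,
     λ { (v , p) → v , λ { refl → cong (v ,_) (≡-irrelevant _ _) } }) ,
  λ a b → refl
  where open Decidable⇒UIP _≟_

⊆⇒⊑°FO : ∀ {C D} → C ⊆ᶜ D → C ⊑°FO D
⊆⇒⊑°FO C⊆D = 0 , identityInterp , λ H h → H , C⊆D H h , identityInterp-produces H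

⊑°FO-respˡ-⊆ : ∀ {C C′ D} → C′ ⊆ᶜ C → C ⊑°FO D → C′ ⊑°FO D
⊑°FO-respˡ-⊆ C′⊆C (s , I , produce) = s , I , λ H h → produce H (C′⊆C H h)

⊑°FO-respʳ-⊆ : ∀ {C D D′} → D ⊆ᶜ D′ → C ⊑°FO D → C ⊑°FO D′
⊑°FO-respʳ-⊆ D⊆D′ (s , I , produce) = s , I , λ H h →
  let (G , g , p) = produce H h in G , D⊆D′ G g , p

module FO  = InclusionCompatible _⊑FO_  ⊆⇒⊑FO  ⊑FO-respˡ-⊆  ⊑FO-respʳ-⊆
module FO° = InclusionCompatible _⊑°FO_ ⊆⇒⊑°FO ⊑°FO-respˡ-⊆ ⊑°FO-respʳ-⊆

fact3p4 : (C D : GraphClass) →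
    (IncomparableFO C D → ((C ∩ᶜ D) ⊏FO C) × (C ⊏FO (C ∪ᶜ D))) ×
    (Incomparable°FO C D → ((C ∩ᶜ D) ⊏°FO C) × (C ⊏°FO (C ∪ᶜ D)))
fact3p4 C D =
  (λ (C⋢D , D⋢C) → FO.∩-⊏ C D C⋢D , FO.⊏-∪ C D D⋢C) ,
  (λ (C⋢D , D⋢C) → FO°.∩-⊏ C D C⋢D , FO°.⊏-∪ C D D⋢C)
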